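{- Let $G$ be a simple undirected graph on $n$ vertices with maximum degree at most $d$, let $S$ be a set of vertices of $G$, let $0<\alpha<1$, let $\ell\ge 1$, and let $s\in S$ be a special vertex for $S$ (i.e. $q_v>\alpha$ for all $v\in S$). If $\langle u,v\rangle$ is a dominant directed edge (with $(u,v)$ an edge of $G_S$), then the dominant path to $v$ passes through the edge $(u,v)$.
   Context: Random walks: all random walks start at $s$, have length $\ell$, and are lazy walks in $G$ in which each edge incident to the current vertex is taken with probability exactly $1/(2d)$ and the walk stays put (self-loop) with the remaining probability. A walk reaches $v$ if it visits $v$ at some point; $q_v$ is the probability that a walk reaches $v$. The path induced by a walk reaching $v$ is the path from $s$ to (the first visit of) $v$ obtained from the walk up to that visit by removing self-loop steps and retraced (backtracked) portions; two walks reach $v$ by the same path if they induce the same path up to $v$. $G_S$ is the subgraph of $G$ induced by $S$. A vertex $v\in S$ is isolated if more than half of the walks that reach $v$ induce the same path (the dominant path to $v$), and furthermore the probability that a walk reaches $v$ and induces a different path is $<\alpha/2$. A directed edge $\langle u,v\rangle$ (where $(u,v)$ is an edge of $G_S$) is dominant if (1) $v$ is isolated and (2) the probability that a walk reaches $v$ without passing through the edge $(u,v)$ is $<\alpha/2$.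
   Formalization: The parameter α ranges over the rationals. -}

module Defs where

open import Data.Nat as ℕ using (ℕ; zero; suc; NonZero; _≤_)
open import Data.Nat.Properties using (m*n≢0)
open import Data.Fin using (Fin; _≟_)
open import Data.Fin.Subset using (Subset; _∈_)
open import Data.Bool using (Bool; true; false; if_then_else_; not; _∨_; _∧_)
open import Data.List using (List; []; _∷_; allFin; map; concatMap; foldr; foldl; reverse)
open import Data.Nat.ListAction using (sum)
open import Data.List.Properties using (≡-dec)
open import Data.Maybe using (Maybe; just; nothing; is-just)
open import Data.Integer using (+_)
open import Data.Rational using (ℚ; 0ℚ; 1ℚ; _+_; _*_; _-_; _<_; _/_)
open import Data.Product using (Σ; _×_)
open import Relation.Nullary.Decidable using (⌊_⌋)
open import Relation.Binary.PropositionalEquality using (_≡_)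

record Graph (n : ℕ) : Set where
  field
    adj    : Fin n → Fin n → Bool
    adj-sym : ∀ x y → adj x y ≡ adj y x
    adj-irrefl : ∀ x → adj x x ≡ false
open Graph public

degree : ∀ {n} → Graph n → Fin n → ℕ
degree {n} G x = sum (map (λ y → if adj G x y then 1 else 0) (allFin n))

MaxDegreeAtMost : ∀ {n} → Graph n → ℕ → Set
MaxDegreeAtMost G d = ∀ x → degree G x ≤ d

infix 7 _==_
_==_ : ∀ {n} → Fin n → Fin n → Bool
x == y = ⌊ x ≟ y ⌋

allSeqs : ∀ {n} → ℕ → List (List (Fin n))
allSeqs {n} zero = [] ∷ []
allSeqs {n} (suc k) = concatMap (λ x → map (x ∷_) (allSeqs k)) (allFin n)

prefixTo : ∀ {n} → Fin n → List (Fin n) → Maybe (List (Fin n))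
prefixTo v [] = nothing
prefixTo v (x ∷ xs) = if x == v then just (x ∷ []) else Data.Maybe.map (x ∷_) (prefixTo v xs)

-- one step of the reduction: stack (top first); drop self-loops, cancel backtracking
reduceStep : ∀ {n} → List (Fin n) → Fin n → List (Fin n)
reduceStep [] x = x ∷ []
reduceStep (t ∷ []) x = if t == x then t ∷ [] else x ∷ t ∷ []
reduceStep (t ∷ t₂ ∷ rest) x =
  if t == x then t ∷ t₂ ∷ rest
  else (if t₂ == x then t₂ ∷ rest else x ∷ t ∷ t₂ ∷ rest)

reducePath : ∀ {n} → List (Fin n) → List (Fin n)
reducePath xs = reverse (foldl reduceStep [] xs)

crossesEdge : ∀ {n} → Fin n → Fin n → List (Fin n) → Bool
crossesEdge u v [] = false
crossesEdge u v (x ∷ []) = false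
crossesEdge u v (x ∷ y ∷ ys) =
  ((x == u ∧ y == v) ∨ (x == v ∧ y == u)) ∨ crossesEdge u v (y ∷ ys)

listEq : ∀ {n} → List (Fin n) → List (Fin n) → Bool
listEq p q = ⌊ ≡-dec _≟_ p q ⌋

half : ℚ
half = + 1 / 2

module Walks {n : ℕ} (G : Graph n) (d : ℕ) .{{d≢0 : NonZero d}} (ℓ : ℕ) (s : Fin n) where

  2d : ℕ
  2d = 2 ℕ.* d

  instance
    2d≢0 : NonZero 2d
    2d≢0 = m*n≢0 2 d

  step : Fin n → Fin n → ℚ
  step x y =
    if x == y then 1ℚ - (+ degree G x / 2d)
    else (if adj G x y then + 1 / 2d else 0ℚ)

  weight : Fin n → List (Fin n) → ℚ
  weight x [] = 1ℚ
  weight x (y ∷ ys) = step x y * weight y ys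

  Pr : (List (Fin n) → Bool) → ℚ
  Pr E = foldr _+_ 0ℚ
    (map (λ ws → if E (s ∷ ws) then weight s ws else 0ℚ) (allSeqs ℓ))

  reaches : Fin n → List (Fin n) → Bool
  reaches v w = is-just (prefixTo v w)

  q : Fin n → ℚ
  q v = Pr (reaches v)

  inducedPath : Fin n → List (Fin n) → Maybe (List (Fin n))
  inducedPath v w = Data.Maybe.map reducePath (prefixTo v w)

  inducesPath : Fin n → List (Fin n) → List (Fin n) → Bool
  inducesPath v P w with inducedPath v w
  ... | just p = listEq p P
  ... | nothing = false

  inducesOtherPath : Fin n → List (Fin n) → List (Fin n) → Bool
  inducesOtherPath v P w with inducedPath v w
  ... | just p = not (listEq p P)
  ... | nothing = false

  reachesAvoiding : Fin n → Fin n → List (Fin n) → Bool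
  reachesAvoiding u v w with prefixTo v w
  ... | just p = not (crossesEdge u v p)
  ... | nothing = false

  DominantPath : Fin n → List (Fin n) → Set
  DominantPath v P = half * q v < Pr (inducesPath v P)

  Isolated : ℚ → Fin n → Set
  Isolated α v = Σ (List (Fin n)) λ P →
    DominantPath v P × (Pr (inducesOtherPath v P) < half * α)

  DominantEdge : Subset n → ℚ → Fin n → Fin n → Set
  DominantEdge S α u v =
    (u ∈ S) × (v ∈ S) × (adj G u v ≡ true) ×
    Isolated α v × (Pr (reachesAvoiding u v) < half * α)

  Special : Subset n → ℚ → Set
  Special S α = (s ∈ S) × (∀ v → v ∈ S → α < q v)

-- If the dominant path P to v avoided the edge (u,v), every walk inducing P would reach v
-- without traversing (u,v): the prefix of a walk up to its first visit of v can only cross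
-- (u,v) in its final step u → v, and erasing self-loops and backtracks keeps that final step.
-- Then q_v/2 < Pr[induces P] ≤ Pr[reaches v avoiding (u,v)] < α/2 < q_v/2.
module Submission where

open import Defs
open import Data.Nat as ℕ using (ℕ; NonZero; suc; _≤_)
import Data.Nat.Properties as ℕ
open import Data.Fin using (Fin; _≟_)
open import Data.Fin.Subset using (Subset)
open import Data.Bool using (Bool; true; false; if_then_else_)
open import Data.Bool.Properties using (∨-zeroʳ; ∧-zeroʳ; T-≡)
open import Data.List using (List; []; _∷_; _++_; foldl; foldr; map; reverse)
open import Data.List.Properties using (foldl-++; reverse-++; ++-assoc)
open import Data.List.Relation.Unary.All using (All; []; _∷_)
open import Data.List.Relation.Unary.All.Properties using (++⁻ˡ)
open import Data.Maybe using (just)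
open import Data.Product using (_,_; _×_; ∃-syntax)
open import Data.Integer as ℤ using (+_; +≤+)
import Data.Integer.Properties as ℤ
open import Data.Rational using (ℚ; 0ℚ; 1ℚ; _<_; _-_; _*_; _+_; _/_; nonNegative)
  renaming (_≤_ to _≤ℚ_)
import Data.Rational.Properties as ℚ
open import Data.Rational.Unnormalised as ℚᵘ using (mkℚᵘ)
import Data.Rational.Unnormalised.Properties as ℚᵘ
open import Function using (Equivalence)
open import Relation.Nullary using (yes; no; contradiction)
open import Relation.Nullary.Decidable using (isYes≗does; dec-true; dec-false; toWitness)
open import Relation.Binary.PropositionalEquality

private variable
  n : ℕ
  u v x : Fin n

==-refl : (x : Fin n) → x == x ≡ true
==-refl x = trans (isYes≗does (x ≟ x)) (dec-true (x ≟ x) refl)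

==-false : x ≢ v → x == v ≡ false
==-false {x = x} {v} x≢v = trans (isYes≗does (x ≟ v)) (dec-false (x ≟ v) x≢v)

listEq-sound : (p P : List (Fin n)) → listEq p P ≡ true → p ≡ P
listEq-sound p P eq = toWitness (Equivalence.from T-≡ eq)

crossesEdge-∷ : (ys : List (Fin n)) → crossesEdge u v ys ≡ true → crossesEdge u v (x ∷ ys) ≡ true
crossesEdge-∷ (y ∷ ys) crosses rewrite crosses = ∨-zeroʳ _

crossesEdge-final : (u v : Fin n) (zs : List (Fin n)) → crossesEdge u v (zs ++ u ∷ v ∷ []) ≡ true
crossesEdge-final u v [] rewrite ==-refl u | ==-refl v = refl
crossesEdge-final u v (z ∷ zs) = crossesEdge-∷ (zs ++ u ∷ v ∷ []) (crossesEdge-final u v zs)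

prefixTo-shape : (v : Fin n) (w p : List (Fin n)) → prefixTo v w ≡ just p →
  ∃[ xs ] p ≡ xs ++ v ∷ [] × All (_≢ v) xs
prefixTo-shape v (x ∷ w) p eq with x ≟ v
prefixTo-shape v (x ∷ w) p refl | yes refl = [] , refl , []
prefixTo-shape v (x ∷ w) p eq   | no x≢v with prefixTo v w in eq′
prefixTo-shape v (x ∷ w) p refl | no x≢v | just p′ with prefixTo-shape v w p′ eq′
... | xs , refl , xs≢v = x ∷ xs , refl , x≢v ∷ xs≢v

crossesEdge-into-last : (xs : List (Fin n)) → All (_≢ v) xs →
  crossesEdge u v (xs ++ v ∷ []) ≡ true → ∃[ ys ] xs ≡ ys ++ u ∷ []
crossesEdge-into-last {u = u} (x ∷ []) (x≢v ∷ []) crosses with x ≟ u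
... | yes refl = [] , refl
... | no _ rewrite ==-false x≢v with crosses
...   | ()
crossesEdge-into-last {v = v} {u} (x ∷ y ∷ xs) (x≢v ∷ y≢v ∷ xs≢v) crosses
  with crossesEdge-into-last (y ∷ xs) (y≢v ∷ xs≢v) (drop-first-step crosses)
  where
  drop-first-step : crossesEdge u v (x ∷ y ∷ xs ++ v ∷ []) ≡ true →
    crossesEdge u v (y ∷ xs ++ v ∷ []) ≡ true
  drop-first-step c rewrite ==-false x≢v | ==-false y≢v | ∧-zeroʳ (x == u) = c
... | ys , xs≡ys++u = x ∷ ys , cong (x ∷_) xs≡ys++u

prefixTo-crossing : (w p : List (Fin n)) → prefixTo v w ≡ just p → crossesEdge u v p ≡ true →
  ∃[ ys ] p ≡ ys ++ u ∷ v ∷ [] × All (_≢ v) ys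
prefixTo-crossing {v = v} {u} w p prefix crosses with prefixTo-shape v w p prefix
... | xs , refl , xs≢v with crossesEdge-into-last xs xs≢v crosses
... | ys , refl = ys , ++-assoc ys (u ∷ []) (v ∷ []) , ++⁻ˡ ys xs≢v

module _ {P : Fin n → Set} where

  reduceStep-All : (st : List (Fin n)) → All P st → P x → All P (reduceStep st x)
  reduceStep-All [] _ px = px ∷ []
  reduceStep-All {x = x} (t ∷ []) pst px with t == x
  ... | true  = pst
  ... | false = px ∷ pst
  reduceStep-All {x = x} (t ∷ t₂ ∷ rest) pst@(_ ∷ prest) px with t == x | t₂ == x
  ... | true  | _     = pst
  ... | false | true  = prest
  ... | false | false = px ∷ pst

  foldl-reduceStep-All : (st xs : List (Fin n)) → All P st → All P xs →
    All P (foldl reduceStep st xs)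
  foldl-reduceStep-All st []       pst []         = pst
  foldl-reduceStep-All st (x ∷ xs) pst (px ∷ pxs) =
    foldl-reduceStep-All (reduceStep st x) xs (reduceStep-All st pst px) pxs

  reduceStep-top : (st : List (Fin n)) (x : Fin n) → All P st →
    ∃[ r ] reduceStep st x ≡ x ∷ r × All P r
  reduceStep-top [] x _ = [] , refl , []
  reduceStep-top (t ∷ []) x pst with t ≟ x
  ... | yes refl = [] , refl , []
  ... | no _     = t ∷ [] , refl , pst
  reduceStep-top (t ∷ t₂ ∷ rest) x pst@(_ ∷ prest@(_ ∷ prest₂)) with t ≟ x | t₂ ≟ x
  ... | yes refl | _        = t₂ ∷ rest , refl , prest
  ... | no _     | yes refl = rest , refl , prest₂
  ... | no _     | no _     = t ∷ t₂ ∷ rest , refl , pst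

reduceStep-push : u ≢ v → (r : List (Fin n)) → All (_≢ v) r → reduceStep (u ∷ r) v ≡ v ∷ u ∷ r
reduceStep-push u≢v []      _         rewrite ==-false u≢v = refl
reduceStep-push u≢v (t ∷ r) (t≢v ∷ _) rewrite ==-false u≢v | ==-false t≢v = refl

reducePath-final : u ≢ v → (ys : List (Fin n)) → All (_≢ v) ys →
  ∃[ zs ] reducePath (ys ++ u ∷ v ∷ []) ≡ zs ++ u ∷ v ∷ []
reducePath-final {u = u} {v} u≢v ys ys≢v
  with reduceStep-top (foldl reduceStep [] ys) u (foldl-reduceStep-All [] ys [] ys≢v)
... | r , top , r≢v = reverse r , (begin
  reverse (foldl reduceStep [] (ys ++ u ∷ v ∷ []))  ≡⟨ cong reverse (foldl-++ reduceStep [] ys _) ⟩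
  reverse (reduceStep (reduceStep st u) v)          ≡⟨ cong (λ t → reverse (reduceStep t v)) top ⟩
  reverse (reduceStep (u ∷ r) v)                    ≡⟨ cong reverse (reduceStep-push u≢v r r≢v) ⟩
  reverse ((v ∷ u ∷ []) ++ r)                       ≡⟨ reverse-++ (v ∷ u ∷ []) r ⟩
  reverse r ++ u ∷ v ∷ []                           ∎)
  where
  open ≡-Reasoning
  st = foldl reduceStep [] ys

reducePath-crossing : u ≢ v → (w p : List (Fin n)) → prefixTo v w ≡ just p →
  crossesEdge u v p ≡ true → crossesEdge u v (reducePath p) ≡ true
reducePath-crossing {u = u} {v} u≢v w p prefix crosses with prefixTo-crossing w p prefix crosses
... | ys , refl , ys≢v with reducePath-final u≢v ys ys≢v
... | zs , reduced = subst (λ q → crossesEdge u v q ≡ true) (sym reduced) (crossesEdge-final u v zs)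

k/m≤1 : ∀ k m .{{_ : NonZero m}} → k ≤ m → + k / m ≤ℚ 1ℚ
k/m≤1 k (suc m) k≤m = ℚ.toℚᵘ-cancel-≤
  (ℚᵘ.≤-respˡ-≃ (ℚᵘ.≃-sym (ℚ.toℚᵘ-fromℚᵘ (mkℚᵘ (+ k) m))) (ℚᵘ.*≤* k*1≤1*m))
  where
  k*1≤1*m : + k ℤ.* + 1 ℤ.≤ + 1 ℤ.* + suc m
  k*1≤1*m = subst₂ ℤ._≤_ (sym (ℤ.*-identityʳ (+ k))) (sym (ℤ.*-identityˡ (+ suc m))) (+≤+ k≤m)

p≤q⇒0≤q-p : ∀ {p q} → p ≤ℚ q → 0ℚ ≤ℚ q - p
p≤q⇒0≤q-p {p} {q} p≤q = subst (_≤ℚ q - p) (ℚ.+-inverseʳ q) (ℚ.+-monoʳ-≤ q (ℚ.neg-antimono-≤ p≤q))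

sum-mono : {A : Set} (f g : A → ℚ) → (∀ a → f a ≤ℚ g a) →
  ∀ as → foldr _+_ 0ℚ (map f as) ≤ℚ foldr _+_ 0ℚ (map g as)
sum-mono f g f≤g []       = ℚ.≤-refl
sum-mono f g f≤g (a ∷ as) = ℚ.+-mono-≤ (f≤g a) (sum-mono f g f≤g as)

module _ {n : ℕ} (G : Graph n) (d : ℕ) .{{_ : NonZero d}} (ℓ : ℕ) (s : Fin n) where
  open Walks G d ℓ s

  module _ (maxDegree : MaxDegreeAtMost G d) where

    step-nonNeg : ∀ x y → 0ℚ ≤ℚ step x y
    step-nonNeg x y with x == y
    ... | true = p≤q⇒0≤q-p (k/m≤1 (degree G x) 2d (ℕ.≤-trans (maxDegree x) (ℕ.m≤n*m d 2)))
    ... | false with adj G x y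
    ...   | true  = ℚ.nonNegative⁻¹ (+ 1 / 2d) {{ℚ.normalize-nonNeg 1 2d}}
    ...   | false = ℚ.≤-refl

    weight-nonNeg : ∀ x ys → 0ℚ ≤ℚ weight x ys
    weight-nonNeg x []       = ℚ.nonNegative⁻¹ 1ℚ
    weight-nonNeg x (y ∷ ys) = ℚ.nonNegative⁻¹ _
      {{ℚ.nonNeg*nonNeg⇒nonNeg (step x y) {{nonNegative (step-nonNeg x y)}}
                                (weight y ys) {{nonNegative (weight-nonNeg y ys)}}}}

    Pr-mono : (E F : List (Fin n) → Bool) → (∀ w → E w ≡ true → F w ≡ true) → Pr E ≤ℚ Pr F
    Pr-mono E F E⇒F = sum-mono (term E) (term F) term-mono (allSeqs ℓ)
      where
      term : (List (Fin n) → Bool) → List (Fin n) → ℚ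
      term A ws = if A (s ∷ ws) then weight s ws else 0ℚ
      term-mono : ∀ ws → term E ws ≤ℚ term F ws
      term-mono ws with E (s ∷ ws) in e
      ... | true rewrite E⇒F (s ∷ ws) e = ℚ.≤-refl
      ... | false with F (s ∷ ws)
      ...   | true  = weight-nonNeg s ws
      ...   | false = ℚ.≤-refl

  inducesPath⇒reachesAvoiding : ∀ {u v} → u ≢ v → (P : List (Fin n)) → crossesEdge u v P ≡ false →
    ∀ w → inducesPath v P w ≡ true → reachesAvoiding u v w ≡ true
  inducesPath⇒reachesAvoiding {u} {v} u≢v P P-avoids w induces with prefixTo v w in prefix
  ... | just p with crossesEdge u v p in p-crosses
  ...   | false = refl
  ...   | true  = contradiction (trans (sym P-avoids) P-crosses) λ ()
    where
    P-crosses : crossesEdge u v P ≡ true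
    P-crosses = subst (λ q → crossesEdge u v q ≡ true) (listEq-sound _ P induces)
                      (reducePath-crossing u≢v w p prefix p-crosses)

claim1 : ∀ {n : ℕ} (G : Graph n) (d : ℕ) .{{_ : NonZero d}} → MaxDegreeAtMost G d →
  (S : Subset n) (α : ℚ) → 0ℚ < α → α < 1ℚ → (ℓ : ℕ) → 1 ≤ ℓ → (s : Fin n) →
  Walks.Special G d ℓ s S α →
  (u v : Fin n) → Walks.DominantEdge G d ℓ s S α u v →
  (P : List (Fin n)) → Walks.DominantPath G d ℓ s v P →
  crossesEdge u v P ≡ true
claim1 G d maxDegree S α _ _ ℓ _ s (_ , α<q) u v (_ , v∈S , uv∈G , _ , avoiding<α/2) P dominant
  with crossesEdge u v P in P-avoids
... | true  = refl
... | false = contradiction impossible (ℚ.<-irrefl refl)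
  where
  open Walks G d ℓ s
  open ℚ.≤-Reasoning

  u≢v : u ≢ v
  u≢v refl = contradiction (trans (sym uv∈G) (adj-irrefl G u)) λ ()

  impossible : half * q v < half * q v
  impossible = begin-strict
    half * q v               <⟨ dominant ⟩
    Pr (inducesPath v P)     ≤⟨ Pr-mono G d ℓ s maxDegree _ _
                                  (inducesPath⇒reachesAvoiding G d ℓ s u≢v P P-avoids) ⟩
    Pr (reachesAvoiding u v) <⟨ avoiding<α/2 ⟩
    half * α                 <⟨ ℚ.*-monoʳ-<-pos half {{ℚ.normalize-pos 1 2}} (α<q v v∈S) ⟩
    half * q v               ∎
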